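{- For every integer $k\ge 1$, if $G$ is an acyclic digraph with $|G|\ge 2$ and exactly one source, then $G$ has a $k$-kernel of size at most $1+(|G|-2)/k$.
   Context: A digraph is a finite directed graph with no loops or parallel edges; acyclic means no directed cycle. A source is a vertex of in-degree zero. A set is stable if no edge has both ends in it. A $k$-kernel is a stable set $X$ such that every vertex is reachable from some vertex of $X$ by a directed path of length at most $k$ (length $0$ allowed). $|G|$ is the number of vertices. -}

module Defs where

open import Data.Nat using (ℕ; zero; suc; _≤_; _<_; _*_; _+_; _∸_)
open import Data.Fin using (Fin)
open import Data.Fin.Subset using (Subset; _∈_; ∣_∣)
open import Data.Product using (Σ; _×_; ∃-syntax)
open import Relation.Nullary using (¬_; Dec)
open import Relation.Binary.PropositionalEquality using (_≡_)

-- A digraph on vertex set Fin n: an edge relation (u → v), decidable, with no loops.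
-- Parallel edges are excluded automatically since edges form a relation.
record Digraph (n : ℕ) : Set₁ where
  field
    Edge   : Fin n → Fin n → Set
    edge?  : (u v : Fin n) → Dec (Edge u v)
    noLoop : (v : Fin n) → ¬ Edge v v
open Digraph public

data Walk {n : ℕ} (G : Digraph n) : Fin n → Fin n → ℕ → Set where
  here : (v : Fin n) → Walk G v v 0
  step : {u w v : Fin n} {ℓ : ℕ} → Edge G u w → Walk G w v ℓ → Walk G u v (suc ℓ)

Acyclic : {n : ℕ} → Digraph n → Set
Acyclic G = ∀ v ℓ → ¬ Walk G v v (suc ℓ)

IsSource : {n : ℕ} → Digraph n → Fin n → Set
IsSource G v = ∀ u → ¬ Edge G u v

UniqueSource : {n : ℕ} → Digraph n → Set
UniqueSource G = Σ _ λ s → IsSource G s × (∀ v → IsSource G v → v ≡ s)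

Stable : {n : ℕ} → Digraph n → Subset n → Set
Stable G X = ∀ u v → u ∈ X → v ∈ X → ¬ Edge G u v

-- k-kernel: stable, and every vertex is reachable from X by a directed path of
-- length ≤ k (length 0 allowed).  (A walk of length ≤ k contains a path of
-- length ≤ k between the same endpoints, so using walks is equivalent.)
IsKKernel : {n : ℕ} → Digraph n → ℕ → Subset n → Set
IsKKernel G k X = Stable G X × (∀ v → ∃[ x ] ∃[ ℓ ] (x ∈ X × ℓ ≤ k × Walk G x v ℓ))

{-# OPTIONS --safe #-}
-- Let s be the unique source. By acyclicity every vertex is reachable from s;
-- let d be the distance from s. For each residue c mod k put
-- Y_c = {s} ∪ {v : d v ≡ c (mod k)}, and let X_c be a stable subset of Y_c
-- that reaches every other vertex of Y_c by one edge (built greedily, which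
-- terminates because G is acyclic). Walking back along a shortest path from any
-- vertex meets Y_c within k − 1 steps, hence X_c within k, so X_c is a k-kernel.
-- Each X_c contains s, so misses an out-neighbour w of s, and the sets X_c ∖ {s}
-- are pairwise disjoint; thus Σ_c |X_c| ≤ k + (|G| − 2), and the smallest X_c
-- is at most average.
module Submission where

open import Defs
open import Level using (0ℓ)
open import Data.Nat using (ℕ; zero; suc; _≤_; _<_; _*_; _+_; _∸_; z≤n; s≤s; s<s⁻¹; _%_; NonZero)
open import Data.Nat.Properties
open import Data.Nat.Induction using (<-rec)
open import Data.Nat.DivMod using (_mod_; _/_; m%n<n; m≡m%n+[m/n]*n; [m+kn]%n≡m%n; m<n⇒m%n≡m)
open import Data.Fin as Fin using (Fin; zero; suc; toℕ; punchOut)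
open import Data.Fin.Properties using (pigeonhole; any?; toℕ<n; toℕ-fromℕ<; toℕ-injective; punchInᵢ≢i; punchIn-punchOut)
open import Data.Product using (Σ; _×_; _,_; proj₁; proj₂; ∃₂; ∃-syntax; ∄-syntax)
open import Data.Bool using (Bool; true)
open import Data.Vec using ([]; _∷_; tabulate; lookup)
open import Data.Vec.Properties using (lookup∘tabulate; []=⇒lookup; lookup⇒[]=)
open import Data.Vec.Functional using (removeAt)
open import Data.Fin.Subset using (Subset; Side; inside; outside; _∈_; _∉_; _⊆_; ∣_∣; ⊥; ⁅_⁆)
open import Data.Fin.Subset.Properties using (_∈?_; ∣p∣≤n; p⊆q⇒∣p∣≤∣q∣; ∣⊥∣≡0; ∣⁅x⁆∣≡1; x∈⁅x⁆)
open import Data.Sum using (_⊎_; inj₁; inj₂)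
open import Function using (_∘_; _⇔_; mk⇔; Equivalence)
open import Function.Properties.Equivalence using () renaming (trans to ⇔-trans)
open import Relation.Nullary using (Dec; yes; no; contradiction)
open import Relation.Nullary.Decidable using (_×-dec_; _⊎-dec_; ¬?; does)
open import Relation.Unary using (Pred; Decidable)
open import Relation.Binary.PropositionalEquality
open import Algebra.Properties.CommutativeMonoid.Sum +-0-commutativeMonoid
  using (sum; sum-syntax; sum-cong-≗; sum-remove; ∑-comm)

module _ {n} {G : Digraph n} where

  _++_ : ∀ {x y z a b} → Walk G x y a → Walk G y z b → Walk G x z (a + b)
  here _   ++ w′ = w′
  step e w ++ w′ = step e (w ++ w′)

  splitAt : ∀ a {b x z} → Walk G x z (a + b) → ∃[ y ] (Walk G x y a × Walk G y z b)
  splitAt zero    w          = _ , here _ , w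
  splitAt (suc a) (step e w) with y , w₁ , w₂ ← splitAt a w = y , step e w₁ , w₂

  snoc : ∀ {x u v ℓ} → Walk G x u ℓ → Edge G u v → Walk G x v (suc ℓ)
  snoc (here _)   e = step e (here _)
  snoc (step e′ w) e = step e′ (snoc w e)

  vertex : ∀ {x y ℓ} → Walk G x y ℓ → Fin (suc ℓ) → Fin n
  vertex {x = x} _ zero    = x
  vertex (step e w) (suc i) = vertex w i

  prefix : ∀ {x y ℓ} (w : Walk G x y ℓ) (i : Fin (suc ℓ)) → Walk G x (vertex w i) (toℕ i)
  prefix _          zero    = here _
  prefix (step e w) (suc i) = step e (prefix w i)

  repeated-vertex⇒cycle : ∀ {x y ℓ} (w : Walk G x y ℓ) {i j : Fin (suc ℓ)} →
    i Fin.< j → vertex w i ≡ vertex w j → ∃₂ λ v m → Walk G v v (suc m)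
  repeated-vertex⇒cycle (step e w) {zero}  {suc j} _         x≡w[j] =
    _ , _ , subst (λ z → Walk G _ z _) (sym x≡w[j]) (step e (prefix w j))
  repeated-vertex⇒cycle (step e w) {suc i} {suc j} (s≤s i<j) w[i]≡w[j] =
    repeated-vertex⇒cycle w i<j w[i]≡w[j]

  first-edge : ∀ {x y ℓ} → Walk G x y ℓ → x ≢ y → ∃[ w ] Edge G x w
  first-edge (here _)   x≢x = contradiction refl x≢x
  first-edge (step e _) _   = _ , e

walk? : ∀ {n} (G : Digraph n) ℓ x v → Dec (Walk G x v ℓ)
walk? G zero x v with x Fin.≟ v
... | yes refl = yes (here x)
... | no x≢v   = no λ { (here _) → x≢v refl }
walk? G (suc ℓ) x v with any? (λ w → edge? G x w ×-dec walk? G ℓ w v)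
... | yes (w , e , p) = yes (step e p)
... | no ∄w           = no λ { (step e p) → ∄w (_ , e , p) }

module _ {n} {G : Digraph n} (acyclic : Acyclic G) where

  walk-length<n : ∀ {x y ℓ} → Walk G x y ℓ → ℓ < n
  walk-length<n {ℓ = ℓ} w with n ≤? ℓ
  ... | no  n≰ℓ = ≰⇒> n≰ℓ
  ... | yes n≤ℓ with i , j , i<j , w[i]≡w[j] ← pigeonhole (s≤s n≤ℓ) (vertex w)
                with v , m , cycle ← repeated-vertex⇒cycle w i<j w[i]≡w[j]
                = contradiction cycle (acyclic v m)

  private
    source-walk-or-walk-of-length : ∀ ℓ v →
      (∃₂ λ x m → IsSource G x × Walk G x v m) ⊎ (∃[ x ] Walk G x v ℓ)
    source-walk-or-walk-of-length zero    v = inj₂ (v , here v)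
    source-walk-or-walk-of-length (suc ℓ) v with source-walk-or-walk-of-length ℓ v
    ... | inj₁ found   = inj₁ found
    ... | inj₂ (x , w) with any? (λ u → edge? G u x)
    ...   | yes (u , e) = inj₂ (u , step e w)
    ...   | no ∄u       = inj₁ (x , ℓ , (λ u e → ∄u (u , e)) , w)

  reachable-from-source : ∀ v → ∃₂ λ x m → IsSource G x × Walk G x v m
  reachable-from-source v with source-walk-or-walk-of-length n v
  ... | inj₁ found  = found
  ... | inj₂ (_ , w) = contradiction (walk-length<n w) (n≮n n)

Least : ∀ {p} → Pred ℕ p → Set p
Least P = ∃[ j ] (P j × ∀ {i} → P i → j ≤ i)

least : ∀ {p} {P : Pred ℕ p} → Decidable P → ∀ {m} → P m → Least P
least {P = P} P? {m} = <-rec (λ m → P m → Least P) search m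
  where
  search : ∀ m → (∀ {i} → i < m → P i → Least P) → P m → Least P
  search m rec pm with anyUpTo? P? m
  ... | yes (i , i<m , pi) = rec i<m pi
  ... | no ∄i              = m , pm , λ {i} pi → ≮⇒≥ λ i<m → ∄i (i , i<m , pi)

module Distance {n} (G : Digraph n) (s : Fin n) (reachable : ∀ v → ∃[ ℓ ] Walk G s v ℓ) where

  private
    shortest : ∀ v → Least (Walk G s v)
    shortest v = least (λ ℓ → walk? G ℓ s v) (proj₂ (reachable v))

  dist : Fin n → ℕ
  dist v = proj₁ (shortest v)

  dist-walk : ∀ v → Walk G s v (dist v)
  dist-walk v = proj₁ (proj₂ (shortest v))

  dist-minimal : ∀ {v ℓ} → Walk G s v ℓ → dist v ≤ ℓ
  dist-minimal {v} = proj₂ (proj₂ (shortest v))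

  ancestor : ∀ {t} v → t ≤ dist v → ∃[ u ] (dist u + t ≡ dist v × Walk G u v t)
  ancestor {t} v t≤d with u , w₁ , w₂ ← splitAt (dist v ∸ t) (subst (Walk G s v) (sym (m∸n+n≡m t≤d)) (dist-walk v))
    = u , ≤-antisym dist-u+t≤ (dist-minimal (dist-walk u ++ w₂)) , w₂
    where
    dist-u+t≤ : dist u + t ≤ dist v
    dist-u+t≤ = ≤-trans (+-monoˡ-≤ t (dist-minimal w₁)) (≤-reflexive (m∸n+n≡m t≤d))

mod-descent : ∀ {K} .{{_ : NonZero K}} (c : Fin K) {a m} →
  toℕ c ≤ m → a + (m ∸ toℕ c) % K ≡ m → a mod K ≡ c
mod-descent {K} c {a} {m} c≤m a+r≡m = toℕ-injective (begin
  toℕ (a mod K)          ≡⟨ toℕ-fromℕ< (m%n<n a K) ⟩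
  a % K                  ≡⟨ cong (_% K) a≡c+qK ⟩
  (toℕ c + q * K) % K    ≡⟨ [m+kn]%n≡m%n (toℕ c) q K ⟩
  toℕ c % K              ≡⟨ m<n⇒m%n≡m (toℕ<n c) ⟩
  toℕ c                  ∎)
  where
  open ≡-Reasoning
  d q r : ℕ
  d = m ∸ toℕ c
  q = d / K
  r = d % K
  a≡c+qK : a ≡ toℕ c + q * K
  a≡c+qK = +-cancelʳ-≡ r a (toℕ c + q * K) (begin
    a + r                  ≡⟨ a+r≡m ⟩
    m                      ≡⟨ m+[n∸m]≡n c≤m ⟨
    toℕ c + d              ≡⟨ cong (toℕ c +_) (m≡m%n+[m/n]*n d K) ⟩
    toℕ c + (r + q * K)    ≡⟨ cong (toℕ c +_) (+-comm r (q * K)) ⟩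
    toℕ c + (q * K + r)    ≡⟨ +-assoc (toℕ c) (q * K) r ⟨
    toℕ c + q * K + r      ∎)

∈-tabulate : ∀ {n} (f : Fin n → Bool) {v} → v ∈ tabulate f ⇔ f v ≡ true
∈-tabulate f {v} = mk⇔ (λ v∈ → trans (sym (lookup∘tabulate f v)) ([]=⇒lookup v∈))
                       (λ fv → lookup⇒[]= v (tabulate f) (trans (lookup∘tabulate f v) fv))

does≡true⇔ : ∀ {A : Set} (a? : Dec A) → does a? ≡ true ⇔ A
does≡true⇔ (yes a) = mk⇔ (λ _ → a) (λ _ → refl)
does≡true⇔ (no ¬a) = mk⇔ (λ ()) (λ a → contradiction a ¬a)

⟦_⟧ : ∀ {n} {P : Pred (Fin n) 0ℓ} → Decidable P → Subset n
⟦ P? ⟧ = tabulate (does ∘ P?)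

∈⟦⟧ : ∀ {n} {P : Pred (Fin n) 0ℓ} (P? : Decidable P) {v} → v ∈ ⟦ P? ⟧ ⇔ P v
∈⟦⟧ P? {v} = ⇔-trans (∈-tabulate (does ∘ P?)) (does≡true⇔ (P? v))

record IsInducedKernel {n} (G : Digraph n) (Y : Pred (Fin n) 0ℓ) (Z : Subset n) : Set where
  field
    ⊆Y        : ∀ {v} → v ∈ Z → Y v
    stable    : Stable G Z
    dominates : ∀ {v} → Y v → v ∉ Z → ∃[ u ] (u ∈ Z × Edge G u v)

module InducedKernel {n} {G : Digraph n} (acyclic : Acyclic G)
                     {Y : Pred (Fin n) 0ℓ} (Y? : Decidable Y) where
  open Equivalence

  Undominated : Subset n → Pred (Fin n) 0ℓ
  Undominated A v = Y v × ∄[ u ] (u ∈ A × Edge G u v)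

  undominated? : ∀ A → Decidable (Undominated A)
  undominated? A v = Y? v ×-dec ¬? (any? λ u → u ∈? A ×-dec edge? G u v)

  greedy : Subset n → Subset n
  greedy A = ⟦ undominated? A ⟧

  ∈-greedy : ∀ {A v} → v ∈ greedy A ⇔ Undominated A v
  ∈-greedy {A} = ∈⟦⟧ (undominated? A)

  greedy-cong : ∀ {A B v} → (∀ {u} → Edge G u v → u ∈ A ⇔ u ∈ B) → v ∈ greedy A ⇔ v ∈ greedy B
  greedy-cong A⇔B = mk⇔ (transfer (from ∘ A⇔B)) (transfer (to ∘ A⇔B))
    where
    transfer : ∀ {A B v} → (∀ {u} → Edge G u v → u ∈ B → u ∈ A) → v ∈ greedy A → v ∈ greedy B
    transfer B⊆A v∈ with y , ∄u ← to ∈-greedy v∈ =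
      from ∈-greedy (y , λ (u , u∈B , e) → ∄u (u , B⊆A e u∈B , e))

  approx : ℕ → Subset n
  approx zero    = ⊥
  approx (suc m) = greedy (approx m)

  approx-stable : ∀ m {v} → (∀ {x ℓ} → Walk G x v ℓ → ℓ < m) → v ∈ approx m ⇔ v ∈ approx (suc m)
  approx-stable zero    short = contradiction (short (here _)) (n≮n 0)
  approx-stable (suc m) short = greedy-cong λ e → approx-stable m λ w → s<s⁻¹ (short (snoc w e))

  kernel : Subset n
  kernel = approx n

  kernel-fixed : ∀ {v} → v ∈ kernel ⇔ Undominated kernel v
  kernel-fixed = ⇔-trans (approx-stable n (walk-length<n acyclic)) ∈-greedy

  kernel-isInducedKernel : IsInducedKernel G Y kernel
  kernel-isInducedKernel = record
    { ⊆Y        = proj₁ ∘ to kernel-fixed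
    ; stable    = λ u v u∈ v∈ e → proj₂ (to kernel-fixed v∈) (u , u∈ , e)
    ; dominates = dominates
    }
    where
    dominates : ∀ {v} → Y v → v ∉ kernel → ∃[ u ] (u ∈ kernel × Edge G u v)
    dominates {v} y v∉ with any? (λ u → u ∈? kernel ×-dec edge? G u v)
    ... | yes found = found
    ... | no ∄u     = contradiction (from kernel-fixed (y , ∄u)) v∉

∑≤n : ∀ {n} (f : Fin n → ℕ) → (∀ i → f i ≤ 1) → ∑[ i < n ] f i ≤ n
∑≤n {zero}  f f≤1 = z≤n
∑≤n {suc n} f f≤1 = +-mono-≤ (f≤1 zero) (∑≤n (f ∘ suc) (f≤1 ∘ suc))

min≤average : ∀ {K} .{{_ : NonZero K}} (a : Fin K → ℕ) → ∃[ c ] (K * a c ≤ ∑[ i < K ] a i)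
min≤average {suc zero}    a = zero , ≤-refl
min≤average {suc (suc K)} a with c , Ka≤∑ ← min≤average (a ∘ suc) with a zero ≤? a (suc c)
... | yes a₀≤ = zero , +-monoʳ-≤ (a zero) (≤-trans (*-monoʳ-≤ (suc K) a₀≤) Ka≤∑)
... | no  a₀≰ = suc c , +-mono-≤ (<⇒≤ (≰⇒> a₀≰)) Ka≤∑

indicator : Side → ℕ
indicator inside  = 1
indicator outside = 0

∣p∣≡∑ : ∀ {n} (p : Subset n) → ∣ p ∣ ≡ ∑[ v < n ] indicator (lookup p v)
∣p∣≡∑ []            = refl
∣p∣≡∑ (inside  ∷ p) = cong suc (∣p∣≡∑ p)
∣p∣≡∑ (outside ∷ p) = ∣p∣≡∑ p

column : ∀ {m n} → (Fin m → Subset n) → Fin n → Subset m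
column X v = tabulate (λ c → lookup (X c) v)

∈-column : ∀ {m n} (X : Fin m → Subset n) {c v} → c ∈ column X v → v ∈ X c
∈-column X {c} {v} c∈ = lookup⇒[]= v (X c) (Equivalence.to (∈-tabulate (λ c → lookup (X c) v)) c∈)

∑∣rows∣≡∑∣columns∣ : ∀ {m n} (X : Fin m → Subset n) →
  ∑[ c < m ] ∣ X c ∣ ≡ ∑[ v < n ] ∣ column X v ∣
∑∣rows∣≡∑∣columns∣ {m} {n} X = begin
  ∑[ c < m ] ∣ X c ∣                                   ≡⟨ sum-cong-≗ (∣p∣≡∑ ∘ X) ⟩
  ∑[ c < m ] ∑[ v < n ] indicator (lookup (X c) v)     ≡⟨ ∑-comm (λ c v → indicator (lookup (X c) v)) ⟩
  ∑[ v < n ] ∑[ c < m ] indicator (lookup (X c) v)     ≡⟨ sum-cong-≗ ∑≡∣column∣ ⟩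
  ∑[ v < n ] ∣ column X v ∣                            ∎
  where
  open ≡-Reasoning
  ∑≡∣column∣ : ∀ v → ∑[ c < m ] indicator (lookup (X c) v) ≡ ∣ column X v ∣
  ∑≡∣column∣ v = trans (sum-cong-≗ λ c → cong indicator (sym (lookup∘tabulate (λ c → lookup (X c) v) c)))
                       (sym (∣p∣≡∑ (column X v)))

∑≤t[s]+n : ∀ {n} (t : Fin (suc (suc n)) → ℕ) {s w} → s ≢ w → t w ≡ 0 →
  (∀ {v} → v ≢ s → t v ≤ 1) → ∑[ v < suc (suc n) ] t v ≤ t s + n
∑≤t[s]+n {n} t {s} {w} s≢w t[w]≡0 t≤1 = begin
  sum t                          ≡⟨ sum-remove t ⟩
  t s + sum t′                   ≡⟨ cong (t s +_) (sum-remove t′) ⟩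
  t s + (t′ j + sum t″)          ≡⟨ cong (λ x → t s + (x + sum t″)) t′[j]≡0 ⟩
  t s + sum t″                   ≤⟨ +-monoʳ-≤ (t s) (∑≤n t″ (λ i → t≤1 (punchInᵢ≢i s _))) ⟩
  t s + n                        ∎
  where
  open ≤-Reasoning
  t′ : Fin (suc n) → ℕ
  t′ = removeAt t s
  j : Fin (suc n)
  j = punchOut s≢w
  t″ : Fin n → ℕ
  t″ = removeAt t′ j
  t′[j]≡0 : t′ j ≡ 0
  t′[j]≡0 = trans (cong t (punchIn-punchOut s≢w)) t[w]≡0

∃-small-member : ∀ {K n} .{{_ : NonZero K}} (r : Fin (suc (suc n)) → Fin K)
  (X : Fin K → Subset (suc (suc n))) {s w} → s ≢ w →
  (∀ {c v} → v ∈ X c → v ≡ s ⊎ r v ≡ c) → (∀ c → w ∉ X c) →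
  ∃[ c ] (K * ∣ X c ∣ ≤ K + n)
∃-small-member {K} {n} r X {s} {w} s≢w X⊆ w∉X with c , K∣Xc∣≤∑ ← min≤average (λ c → ∣ X c ∣) =
  c , (begin
    K * ∣ X c ∣                      ≤⟨ K∣Xc∣≤∑ ⟩
    ∑[ c < K ] ∣ X c ∣               ≡⟨ ∑∣rows∣≡∑∣columns∣ X ⟩
    ∑[ v < suc (suc n) ] ∣ column X v ∣
      ≤⟨ ∑≤t[s]+n (∣_∣ ∘ column X) s≢w ∣column-w∣≡0 ∣column-v∣≤1 ⟩
    ∣ column X s ∣ + n               ≤⟨ +-monoˡ-≤ n (∣p∣≤n (column X s)) ⟩
    K + n                            ∎)
  where
  open ≤-Reasoning
  ∣column-w∣≡0 : ∣ column X w ∣ ≡ 0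
  ∣column-w∣≡0 = n≤0⇒n≡0 (≤-trans (p⊆q⇒∣p∣≤∣q∣ {q = ⊥} λ {c} c∈ → contradiction (∈-column X c∈) (w∉X c))
                                  (≤-reflexive (∣⊥∣≡0 K)))
  ∣column-v∣≤1 : ∀ {v} → v ≢ s → ∣ column X v ∣ ≤ 1
  ∣column-v∣≤1 {v} v≢s = ≤-trans (p⊆q⇒∣p∣≤∣q∣ column⊆) (≤-reflexive (∣⁅x⁆∣≡1 (r v)))
    where
    column⊆ : column X v ⊆ ⁅ r v ⁆
    column⊆ c∈ with X⊆ (∈-column X c∈)
    ... | inj₁ v≡s  = contradiction v≡s v≢s
    ... | inj₂ rv≡c = subst (_∈ ⁅ r v ⁆) rv≡c (x∈⁅x⁆ (r v))

module WithUniqueSource {n} {G : Digraph n} (acyclic : Acyclic G) {s} (s-source : IsSource G s)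
                        (s-unique : ∀ v → IsSource G v → v ≡ s) where

  reachable : ∀ v → ∃[ ℓ ] Walk G s v ℓ
  reachable v with x , ℓ , x-source , w ← reachable-from-source acyclic v =
    ℓ , subst (λ x → Walk G x v ℓ) (s-unique x x-source) w

  out-edge : ∀ {v} → v ≢ s → ∃[ w ] Edge G s w
  out-edge v≢s = first-edge (proj₂ (reachable _)) (v≢s ∘ sym)

  open Distance G s reachable

  module ClassKernels (K : ℕ) .{{_ : NonZero K}} where

    residue : Fin n → Fin K
    residue v = dist v mod K

    InClass : Fin K → Pred (Fin n) 0ℓ
    InClass c v = v ≡ s ⊎ residue v ≡ c

    inClass? : ∀ c → Decidable (InClass c)
    inClass? c v = (v Fin.≟ s) ⊎-dec (residue v Fin.≟ c)

    near-class : ∀ c v → ∃₂ λ u t → InClass c u × t < K × Walk G u v t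
    near-class c v with dist v <? K
    ... | yes d<K = s , dist v , inj₁ refl , d<K , dist-walk v
    ... | no  d≮K =
      let u , u+t≡d , w = ancestor v t≤d in u , t , inj₂ (mod-descent c c≤d u+t≡d) , m%n<n _ K , w
      where
      K≤d : K ≤ dist v
      K≤d = ≮⇒≥ d≮K
      t : ℕ
      t = (dist v ∸ toℕ c) % K
      t≤d : t ≤ dist v
      t≤d = ≤-trans (<⇒≤ (m%n<n _ K)) K≤d
      c≤d : toℕ c ≤ dist v
      c≤d = ≤-trans (<⇒≤ (toℕ<n c)) K≤d

    classKernel : Fin K → Subset n
    classKernel c = InducedKernel.kernel acyclic (inClass? c)

    module _ (c : Fin K) where
      open IsInducedKernel (InducedKernel.kernel-isInducedKernel acyclic (inClass? c))

      classKernel⊆InClass : ∀ {v} → v ∈ classKernel c → InClass c v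
      classKernel⊆InClass = ⊆Y

      classKernel-isKKernel : IsKKernel G K (classKernel c)
      classKernel-isKKernel = stable , cover
        where
        cover : ∀ v → ∃[ x ] ∃[ ℓ ] (x ∈ classKernel c × ℓ ≤ K × Walk G x v ℓ)
        cover v with u , t , u∈Y , t<K , w ← near-class c v with u ∈? classKernel c
        ... | yes u∈ = u , t , u∈ , <⇒≤ t<K , w
        ... | no  u∉ with x , x∈ , e ← dominates u∈Y u∉ = x , suc t , x∈ , t<K , step e w

      source∈classKernel : s ∈ classKernel c
      source∈classKernel with s ∈? classKernel c
      ... | yes s∈ = s∈
      ... | no  s∉ with u , _ , u→s ← dominates (inj₁ refl) s∉ = contradiction u→s (s-source u)

      out-neighbour∉classKernel : ∀ {w} → Edge G s w → w ∉ classKernel c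
      out-neighbour∉classKernel s→w w∈ = stable _ _ source∈classKernel w∈ s→w

mainTheorem7 : (k : ℕ) → 1 ≤ k → (n : ℕ) → 2 ≤ n → (G : Digraph n) →
    Acyclic G → UniqueSource G →
    Σ (Subset n) (λ X → IsKKernel G k X × k * ∣ X ∣ ≤ k + (n ∸ 2))
mainTheorem7 _       _ (suc zero)    (s≤s ()) _ _ _
mainTheorem7 (suc k) _ (suc (suc n)) _ G acyclic (s , s-source , s-unique) =
  let _ , s→w = out-edge (punchInᵢ≢i s zero)
      c , small = ∃-small-member residue classKernel (s≢w s→w) (classKernel⊆InClass _)
                                 (λ c → out-neighbour∉classKernel c s→w)
  in classKernel c , classKernel-isKKernel c , small
  where
  open WithUniqueSource acyclic s-source s-unique
  open ClassKernels (suc k)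
  s≢w : ∀ {w} → Edge G s w → s ≢ w
  s≢w e refl = noLoop G s e
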